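{- For every fixed integer $t\ge 1$ and every fixed integer $r\ge 3$, $\mathrm{ex}(n,K_r,F_t)=O(n)$ as $n\to\infty$.
   Context: For graphs $H,F$, $\mathrm{ex}(n,H,F)$ denotes the maximum number of copies of $H$ in an $n$-vertex graph containing no copy of $F$ (as a subgraph). $K_r$ is the complete graph on $r$ vertices. The $t$-fan $F_t$ has vertices $u,v_1,\dots,v_t,w_1,\dots,w_t$ and edges $uv_i,uw_i,v_iw_i$ for $1\le i\le t$ ($t$ triangles sharing one vertex). -}

module Defs where

open import Data.Nat using (ℕ; zero; suc; _+_; _*_)
open import Data.Bool using (Bool; true; false; _∧_; if_then_else_)
open import Data.Fin using (Fin; zero; suc)
open import Data.Fin.Subset using (Subset; ∣_∣)
open import Data.Vec using (Vec; []; _∷_; _++_; map)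
open import Data.List using (List; []; _∷_; length; filter; allFin)
import Data.List as L
open import Data.Nat using (_≟_)
open import Relation.Binary.PropositionalEquality using (_≡_)
open import Relation.Nullary using (¬_)
open import Relation.Nullary.Decidable using (⌊_⌋)
open import Data.Product using (Σ; _×_)
open import Function.Definitions using (Injective)

record Graph (n : ℕ) : Set where
  field
    adj   : Fin n → Fin n → Bool
    sym   : ∀ x y → adj x y ≡ adj y x
    irrefl : ∀ x → adj x x ≡ false
open Graph public

allSubsets : (n : ℕ) → List (Subset n)
allSubsets zero = [] ∷ []
allSubsets (suc n) =
  L.map (true ∷_) (allSubsets n) L.++ L.map (false ∷_) (allSubsets n)

memb : ∀ {n} → Subset n → Fin n → Bool
memb (b ∷ _) zero = b
memb (_ ∷ s) (suc i) = memb s i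

allV : ∀ {n} → (Fin n → Bool) → Bool
allV {n} p = L.foldr (λ i b → p i ∧ b) true (allFin n)

isClique : ∀ {n} → Graph n → Subset n → Bool
isClique {n} G S =
  allV (λ x → allV (λ y →
    if memb S x ∧ memb S y
    then (if ⌊ Data.Fin._≟_ x y ⌋ then true else adj G x y)
    else true))

numKr : ∀ {n} → ℕ → Graph n → ℕ
numKr {n} r G =
  length (L.filter (λ S → (isClique G S ∧ ⌊ ∣ S ∣ ≟ r ⌋) Data.Bool.≟ true) (allSubsets n))
  where import Data.Bool

-- The t-fan F_t on vertex set Fin (1 + 2t):
-- centre u = zero, v_i = suc (inject i), w_i = suc (raise t i) for i : Fin t.
-- Edge relation of F_t (as a relation on its vertices).
data FanEdge (t : ℕ) : Fin (suc (t + t)) → Fin (suc (t + t)) → Set where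
  uv : (i : Fin t) → FanEdge t zero (suc (i Data.Fin.↑ˡ t))
  uw : (i : Fin t) → FanEdge t zero (suc (t Data.Fin.↑ʳ i))
  vw : (i : Fin t) → FanEdge t (suc (i Data.Fin.↑ˡ t)) (suc (t Data.Fin.↑ʳ i))

ContainsFan : ∀ {n} → ℕ → Graph n → Set
ContainsFan {n} t G =
  Σ (Fin (suc (t + t)) → Fin n) λ f →
    Injective _≡_ _≡_ f × (∀ a b → FanEdge t a b → adj G (f a) (f b) ≡ true)

{-# OPTIONS --safe #-}
-- A greedy maximal matching in the link of a vertex x (the pairs yz with xyz a triangle) has
-- fewer than t edges, as t of them would form an F_t centred at x. So its at most 2t vertices
-- M x meet every triangle through x outside x. Let hull a = {a} ∪ M a ∪ ⋃ {M y | y ∈ M a}, of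
-- size at most L = 1 + 2t + 4t². A clique S with at least three vertices lies in some hull a:
-- otherwise pick a ∈ S, then x ∈ S outside hull a, then w ∈ S outside hull x; covering the
-- triangles of S through a and x forces w into hull x. Hence each K_r is determined by a vertex a
-- and a subset of hull a, so there are at most 2^L · n of them.
module Submission where

open import Defs hiding (sym)
open import Data.Nat using (ℕ; zero; suc; _+_; _*_; _^_; _≤_; _<_; _≥_; z≤n; s≤s; _≤?_; _≟_)
open import Data.Nat.Properties
open import Data.Bool using (Bool; true; false; _∧_; _∨_; if_then_else_)
import Data.Bool as Bool
open import Data.Bool.Properties using (⇔→≡; ∧-conicalˡ; ∧-conicalʳ; ∨-zeroʳ; T-≡)
open import Data.Fin using (Fin; zero; suc; splitAt; join; inject≤)
import Data.Fin as F
open import Data.Fin.Properties using (any?; splitAt-↑ˡ; splitAt-↑ʳ; join-splitAt; inject≤-injective)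
open import Data.Fin.Subset using (Subset; ∣_∣)
open import Data.Vec using (Vec; []; _∷_; tabulate)
open import Data.Vec.Properties using (tabulate-cong; ∷-injectiveʳ)
open import Data.List using (List; []; _∷_; length; _++_; map; foldr; filter; allFin; lookup; concatMap; cartesianProduct; cartesianProductWith)
open import Data.List.Properties using (length-map; length-++; length-tabulate; length-removeAt′)
open import Data.List.Membership.Propositional using (_∈_; _∉_; lose)
open import Data.List.Membership.Propositional.Properties using (∈-map⁺; ∈-map⁻; ∈-lookup; ∈-++⁺ˡ; ∈-++⁺ʳ; ∈-allFin; ∈-filter⁻; ∈-concatMap⁺; ∈-cartesianProductWith⁺; ∈-cartesianProduct⁺)
open import Data.List.Membership.DecPropositional using (_∈?_)
open import Data.List.Relation.Binary.Subset.Propositional using (_⊆_)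
open import Data.List.Relation.Unary.Any using (here; there; index; _─_)
open import Data.List.Relation.Unary.All as All using (All; _∷_)
open import Data.List.Relation.Unary.All.Properties using (¬Any⇒All¬; All¬⇒¬Any)
open import Data.List.Relation.Unary.AllPairs using (_∷_)
open import Data.List.Relation.Unary.Unique.Propositional using (Unique; [])
open import Data.List.Relation.Unary.Unique.Propositional.Properties using (map⁺; ++⁺; filter⁺)
open import Data.Product using (∃; _×_; _,_; proj₁; proj₂; uncurry)
import Data.Product as Product
open import Data.Sum using (_⊎_; inj₁; inj₂)
import Data.Sum as Sum
open import Data.Empty using (⊥; ⊥-elim)
open import Function using (id; _∘_; mk⇔; Equivalence)
open import Function.Definitions using (Injective)
open import Relation.Nullary using (¬_; Dec; yes; no; does)
open import Relation.Nullary.Decidable using (⌊_⌋; _×-dec_; ¬?; dec-true; decidable-stable; toWitness)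
open import Relation.Binary.Definitions using (DecidableEquality)
open import Relation.Unary using (Decidable)
open import Relation.Binary.PropositionalEquality

module _ {A : Set} where

  ∈-─ : ∀ {x v : A} {ys} (x∈ys : x ∈ ys) → v ∈ ys → v ≢ x → v ∈ (ys ─ x∈ys)
  ∈-─ (here refl) (here refl) v≢x = ⊥-elim (v≢x refl)
  ∈-─ (here refl) (there v∈ys) _ = v∈ys
  ∈-─ (there x∈ys) (here refl) _ = here refl
  ∈-─ (there x∈ys) (there v∈ys) v≢x = there (∈-─ x∈ys v∈ys v≢x)

  unique-⊆⇒length-≤ : ∀ {xs ys : List A} → Unique xs → xs ⊆ ys → length xs ≤ length ys
  unique-⊆⇒length-≤ {[]} _ _ = z≤n
  unique-⊆⇒length-≤ {x ∷ xs} {ys} (x∉xs ∷ xs-unique) xs⊆ys = begin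
    suc (length xs)          ≤⟨ s≤s (unique-⊆⇒length-≤ xs-unique xs⊆ys─x) ⟩
    suc (length (ys ─ x∈ys)) ≡⟨ sym (length-removeAt′ ys (index x∈ys)) ⟩
    length ys                ∎
    where
    open ≤-Reasoning
    x∈ys : x ∈ ys
    x∈ys = xs⊆ys (here refl)
    xs⊆ys─x : xs ⊆ (ys ─ x∈ys)
    xs⊆ys─x v∈xs = ∈-─ x∈ys (xs⊆ys (there v∈xs)) (λ v≡x → All.lookup x∉xs v∈xs (sym v≡x))

length-cartesianProductWith : ∀ {A B C : Set} (f : A → B → C) xs ys →
  length (cartesianProductWith f xs ys) ≡ length xs * length ys
length-cartesianProductWith f [] ys = refl
length-cartesianProductWith f (x ∷ xs) ys = begin
  length (map (f x) ys ++ cartesianProductWith f xs ys)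
    ≡⟨ length-++ (map (f x) ys) ⟩
  length (map (f x) ys) + length (cartesianProductWith f xs ys)
    ≡⟨ cong₂ _+_ (length-map (f x) ys) (length-cartesianProductWith f xs ys) ⟩
  length ys + length xs * length ys ∎
  where open ≡-Reasoning

length-concatMap-≤ : ∀ {A B : Set} {k} (f : A → List B) → (∀ x → length (f x) ≤ k) →
  ∀ xs → length (concatMap f xs) ≤ length xs * k
length-concatMap-≤ f bound [] = z≤n
length-concatMap-≤ f bound (x ∷ xs) = begin
  length (f x ++ concatMap f xs)           ≡⟨ length-++ (f x) ⟩
  length (f x) + length (concatMap f xs)   ≤⟨ +-mono-≤ (bound x) (length-concatMap-≤ f bound xs) ⟩
  _ + length xs * _                        ∎
  where open ≤-Reasoning

-- Subsets of Fin n

infix 4 _∈ₛ_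
_∈ₛ_ : ∀ {n} → Fin n → Subset n → Set
v ∈ₛ S = memb S v ≡ true

length-allSubsets : ∀ k → length (allSubsets k) ≡ 2 ^ k
length-allSubsets zero = refl
length-allSubsets (suc k) = begin
  length (map (true ∷_) (allSubsets k) ++ map (false ∷_) (allSubsets k))
    ≡⟨ length-++ (map (true ∷_) (allSubsets k)) ⟩
  length (map (true ∷_) (allSubsets k)) + length (map (false ∷_) (allSubsets k))
    ≡⟨ cong₂ _+_ (length-map (true ∷_) (allSubsets k)) (length-map (false ∷_) (allSubsets k)) ⟩
  length (allSubsets k) + length (allSubsets k)
    ≡⟨ cong₂ _+_ (length-allSubsets k) (length-allSubsets k) ⟩
  2 ^ k + 2 ^ k
    ≡⟨ cong (2 ^ k +_) (sym (+-identityʳ (2 ^ k))) ⟩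
  2 ^ suc k ∎
  where open ≡-Reasoning

∈-allSubsets : ∀ {k} (S : Subset k) → S ∈ allSubsets k
∈-allSubsets [] = here refl
∈-allSubsets (true ∷ S) = ∈-++⁺ˡ (∈-map⁺ (true ∷_) (∈-allSubsets S))
∈-allSubsets {suc k} (false ∷ S) =
  ∈-++⁺ʳ (map (true ∷_) (allSubsets k)) (∈-map⁺ (false ∷_) (∈-allSubsets S))

allSubsets-unique : ∀ k → Unique (allSubsets k)
allSubsets-unique zero = All.[] ∷ []
allSubsets-unique (suc k) =
  ++⁺ (map⁺ ∷-injectiveʳ (allSubsets-unique k)) (map⁺ ∷-injectiveʳ (allSubsets-unique k)) disjoint
  where
  disjoint : ∀ {S} → ¬ (S ∈ map (true ∷_) (allSubsets k) × S ∈ map (false ∷_) (allSubsets k))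
  disjoint (S∈₁ , S∈₂) with ∈-map⁻ (true ∷_) S∈₁ | ∈-map⁻ (false ∷_) S∈₂
  ... | _ , _ , refl | _ , _ , ()

tabulate-memb : ∀ {n} (S : Subset n) → tabulate (memb S) ≡ S
tabulate-memb [] = refl
tabulate-memb (b ∷ S) = cong (b ∷_) (tabulate-memb S)

unshift : ∀ {n} → List (Fin (suc n)) → List (Fin n)
unshift [] = []
unshift (zero ∷ L) = unshift L
unshift (suc i ∷ L) = i ∷ unshift L

∈-unshift : ∀ {n} {i : Fin n} L → suc i ∈ L → i ∈ unshift L
∈-unshift (zero ∷ L) (there i∈L) = ∈-unshift L i∈L
∈-unshift (suc j ∷ L) (here refl) = here refl
∈-unshift (suc j ∷ L) (there i∈L) = there (∈-unshift L i∈L)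

length-unshift-≤ : ∀ {n} (L : List (Fin (suc n))) → length (unshift L) ≤ length L
length-unshift-≤ [] = z≤n
length-unshift-≤ (zero ∷ L) = m≤n⇒m≤1+n (length-unshift-≤ L)
length-unshift-≤ (suc i ∷ L) = s≤s (length-unshift-≤ L)

length-unshift-< : ∀ {n} (L : List (Fin (suc n))) → zero ∈ L → length (unshift L) < length L
length-unshift-< (zero ∷ L) _ = s≤s (length-unshift-≤ L)
length-unshift-< (suc i ∷ L) (there 0∈L) = s≤s (length-unshift-< L 0∈L)

∣S∣≤length : ∀ {n} (S : Subset n) (L : List (Fin n)) → (∀ v → v ∈ₛ S → v ∈ L) → ∣ S ∣ ≤ length L
∣S∣≤length [] L _ = z≤n
∣S∣≤length (true ∷ S) L S⊆L =
  ≤-trans (s≤s (∣S∣≤length S (unshift L) (λ v v∈S → ∈-unshift L (S⊆L (suc v) v∈S))))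
          (length-unshift-< L (S⊆L zero refl))
∣S∣≤length (false ∷ S) L S⊆L =
  ≤-trans (∣S∣≤length S (unshift L) (λ v v∈S → ∈-unshift L (S⊆L (suc v) v∈S)))
          (length-unshift-≤ L)

⊆-or-∃∉ : ∀ {n} (S : Subset n) (L : List (Fin n)) →
  (∀ v → v ∈ₛ S → v ∈ L) ⊎ ∃ λ v → v ∈ₛ S × v ∉ L
⊆-or-∃∉ S L with any? (λ v → (memb S v Bool.≟ true) ×-dec ¬? (_∈?_ F._≟_ v L))
... | yes witness = inj₂ witness
... | no ∄ = inj₁ λ v v∈S → decidable-stable (_∈?_ F._≟_ v L) (λ v∉L → ∄ (v , v∈S , v∉L))

∃∉-of-length< : ∀ {n} (S : Subset n) (L : List (Fin n)) → length L < ∣ S ∣ → ∃ λ v → v ∈ₛ S × v ∉ L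
∃∉-of-length< S L L<S with ⊆-or-∃∉ S L
... | inj₁ S⊆L = ⊥-elim (<⇒≱ L<S (∣S∣≤length S L S⊆L))
... | inj₂ witness = witness

-- Counting subsets that are localised in short lists

-- A subset of the entries of a list of length at most k is stored as k bits, one per position.
mark : ∀ {A : Set} → (A → Bool) → ∀ k → List A → Vec Bool k
mark p zero _ = []
mark p (suc k) [] = false ∷ mark p k []
mark p (suc k) (u ∷ us) = p u ∷ mark p k us

module _ {A : Set} (_≟_ : DecidableEquality A) where

  select : ∀ {k} → Vec Bool k → List A → A → Bool
  select [] _ v = false
  select (b ∷ c) [] v = false
  select (b ∷ c) (u ∷ us) v = (b ∧ does (u ≟ v)) ∨ select c us v

  select-mark⇒ : ∀ p k us {v} → select (mark p k us) us v ≡ true → p v ≡ true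
  select-mark⇒ p (suc k) (u ∷ us) {v} sel with u ≟ v | p u in pu
  ... | yes refl | true = pu
  ... | yes refl | false = select-mark⇒ p k us sel
  ... | no _ | true = select-mark⇒ p k us sel
  ... | no _ | false = select-mark⇒ p k us sel

  select-mark⇐ : ∀ p k us {v} → length us ≤ k → p v ≡ true → v ∈ us → select (mark p k us) us v ≡ true
  select-mark⇐ p (suc k) (u ∷ us) _ pv (here refl) =
    cong (_∨ select (mark p k us) us u) (cong₂ _∧_ pv (dec-true (u ≟ u) refl))
  select-mark⇐ p (suc k) (u ∷ us) (s≤s len) pv (there v∈us) =
    trans (cong (_ ∨_) (select-mark⇐ p k us len pv v∈us)) (∨-zeroʳ _)

decode : ∀ {n k} → List (Fin n) → Vec Bool k → Subset n
decode L c = tabulate (select F._≟_ c L)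

decode-mark : ∀ {n k} (S : Subset n) L → length L ≤ k → (∀ v → v ∈ₛ S → v ∈ L) →
  decode L (mark (memb S) k L) ≡ S
decode-mark {k = k} S L len S⊆L = trans (tabulate-cong same-members) (tabulate-memb S)
  where
  same-members : ∀ v → select F._≟_ (mark (memb S) k L) L v ≡ memb S v
  same-members v = ⇔→≡ (mk⇔ (select-mark⇒ F._≟_ (memb S) k L)
                            (λ v∈S → select-mark⇐ F._≟_ (memb S) k L len v∈S (S⊆L v v∈S)))

count-localised : ∀ {n k} (hull : Fin n → List (Fin n)) → (∀ a → length (hull a) ≤ k) →
  {P : Subset n → Set} (P? : Decidable P) →
  (∀ S → P S → ∃ λ a → ∀ v → v ∈ₛ S → v ∈ hull a) →
  length (filter P? (allSubsets n)) ≤ n * 2 ^ k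
count-localised {n} {k} hull length-hull P? localised = begin
  length (filter P? (allSubsets n))
    ≤⟨ unique-⊆⇒length-≤ (filter⁺ P? {xs = allSubsets n} (allSubsets-unique n)) ⊆candidates ⟩
  length candidates
    ≡⟨ length-cartesianProductWith _ (allFin n) (allSubsets k) ⟩
  length (allFin n) * length (allSubsets k)
    ≡⟨ cong₂ _*_ (length-tabulate {n = n} id) (length-allSubsets k) ⟩
  n * 2 ^ k ∎
  where
  open ≤-Reasoning
  candidates : List (Subset n)
  candidates = cartesianProductWith (λ a → decode (hull a)) (allFin n) (allSubsets k)
  ⊆candidates : filter P? (allSubsets n) ⊆ candidates
  ⊆candidates {S} S∈ with localised S (proj₂ (∈-filter⁻ P? {xs = allSubsets n} S∈))
  ... | a , S⊆hull =
    subst (_∈ candidates) (decode-mark S (hull a) (length-hull a) S⊆hull)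
      (∈-cartesianProductWith⁺ (λ a → decode (hull a)) (∈-allFin a) (∈-allSubsets (mark (memb S) k (hull a))))

-- Greedy maximal matchings

module _ {A : Set} where

  vertices : List (A × A) → List A
  vertices [] = []
  vertices ((y , z) ∷ P) = y ∷ z ∷ vertices P

  length-vertices : ∀ P → length (vertices P) ≡ length P + length P
  length-vertices [] = refl
  length-vertices (_ ∷ P) =
    cong suc (trans (cong suc (length-vertices P)) (sym (+-suc (length P) (length P))))

  pick : Bool → A × A → A
  pick true = proj₁
  pick false = proj₂

  pick-∈ : ∀ P i b → pick b (lookup P i) ∈ vertices P
  pick-∈ (_ ∷ _) zero true = here refl
  pick-∈ (_ ∷ _) zero false = there (here refl)
  pick-∈ (_ ∷ P) (suc i) b = there (there (pick-∈ P i b))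

  pick-∉-tail : ∀ {y z P} → Unique (y ∷ z ∷ vertices P) → ∀ b → pick b (y , z) ∉ vertices P
  pick-∉-tail ((_ ∷ y∉) ∷ _) true = All¬⇒¬Any y∉
  pick-∉-tail (_ ∷ z∉ ∷ _) false = All¬⇒¬Any z∉

  pick-injective : ∀ {P} → Unique (vertices P) → ∀ i j b c →
    pick b (lookup P i) ≡ pick c (lookup P j) → i ≡ j × b ≡ c
  pick-injective {_ ∷ _} _ zero zero true true _ = refl , refl
  pick-injective {_ ∷ _} _ zero zero false false _ = refl , refl
  pick-injective {_ ∷ _} ((y≢z ∷ _) ∷ _) zero zero true false y≡z = ⊥-elim (y≢z y≡z)
  pick-injective {_ ∷ _} ((y≢z ∷ _) ∷ _) zero zero false true z≡y = ⊥-elim (y≢z (sym z≡y))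
  pick-injective {_ ∷ P} u zero (suc j) b c eq =
    ⊥-elim (pick-∉-tail u b (subst (_∈ vertices P) (sym eq) (pick-∈ P j c)))
  pick-injective {_ ∷ P} u (suc i) zero b c eq =
    ⊥-elim (pick-∉-tail u c (subst (_∈ vertices P) eq (pick-∈ P i b)))
  pick-injective {_ ∷ _} (_ ∷ _ ∷ u) (suc i) (suc j) b c eq =
    Product.map₁ (cong suc) (pick-injective u i j b c eq)

module GreedyMatching {A : Set} (_≟_ : DecidableEquality A) {R : A → A → Set}
                      (R? : ∀ y z → Dec (R y z)) (R-irrefl : ∀ {y} → ¬ R y y) where

  extend : A × A → List (A × A) → List (A × A)
  extend (y , z) P with R? y z | _∈?_ _≟_ y (vertices P) | _∈?_ _≟_ z (vertices P)
  ... | yes _ | no _ | no _ = (y , z) ∷ P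
  ... | _ | _ | _ = P

  greedy : List (A × A) → List (A × A)
  greedy = foldr extend []

  extend-⊇ : ∀ q P {v} → v ∈ vertices P → v ∈ vertices (extend q P)
  extend-⊇ (y , z) P v∈ with R? y z | _∈?_ _≟_ y (vertices P) | _∈?_ _≟_ z (vertices P)
  ... | yes _ | no _ | no _ = there (there v∈)
  ... | yes _ | no _ | yes _ = v∈
  ... | yes _ | yes _ | _ = v∈
  ... | no _ | _ | _ = v∈

  extend-covers : ∀ {y z} P → R y z → y ∈ vertices (extend (y , z) P) ⊎ z ∈ vertices (extend (y , z) P)
  extend-covers {y} {z} P r with R? y z | _∈?_ _≟_ y (vertices P) | _∈?_ _≟_ z (vertices P)
  ... | yes _ | no _ | no _ = inj₁ (here refl)
  ... | yes _ | no _ | yes z∈ = inj₂ z∈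
  ... | yes _ | yes y∈ | _ = inj₁ y∈
  ... | no ¬r | _ | _ = ⊥-elim (¬r r)

  IsMatching : List (A × A) → Set
  IsMatching P = All (uncurry R) P × Unique (vertices P)

  extend-isMatching : ∀ q {P} → IsMatching P → IsMatching (extend q P)
  extend-isMatching (y , z) {P} m with R? y z | _∈?_ _≟_ y (vertices P) | _∈?_ _≟_ z (vertices P)
  ... | yes r | no y∉ | no z∉ = let (rs , u) = m in
    r ∷ rs , ((λ y≡z → R-irrefl (subst (R y) (sym y≡z) r)) ∷ ¬Any⇒All¬ _ y∉) ∷ ¬Any⇒All¬ _ z∉ ∷ u
  ... | yes _ | no _ | yes _ = m
  ... | yes _ | yes _ | _ = m
  ... | no _ | _ | _ = m

  greedy-isMatching : ∀ qs → IsMatching (greedy qs)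
  greedy-isMatching [] = All.[] , []
  greedy-isMatching (q ∷ qs) = extend-isMatching q (greedy-isMatching qs)

  greedy-covers : ∀ {y z} qs → (y , z) ∈ qs → R y z →
    y ∈ vertices (greedy qs) ⊎ z ∈ vertices (greedy qs)
  greedy-covers (_ ∷ qs) (here refl) r = extend-covers (greedy qs) r
  greedy-covers (q ∷ qs) (there yz∈) r =
    Sum.map (extend-⊇ q (greedy qs)) (extend-⊇ q (greedy qs)) (greedy-covers qs yz∈ r)

-- Triangles, fans and cliques in a graph

module _ {n : ℕ} (G : Graph n) where

  Adj : Fin n → Fin n → Set
  Adj x y = adj G x y ≡ true

  Triangle : Fin n → Fin n → Fin n → Set
  Triangle x y z = Adj x y × Adj x z × Adj y z

  adj? : ∀ x y → Dec (Adj x y)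
  adj? x y = adj G x y Bool.≟ true

  triangle? : ∀ x y z → Dec (Triangle x y z)
  triangle? x y z = adj? x y ×-dec adj? x z ×-dec adj? y z

  adj⇒≢ : ∀ {x y} → Adj x y → x ≢ y
  adj⇒≢ {x} xy refl with trans (sym xy) (irrefl G x)
  ... | ()

  containsFan : ∀ {t} x (e : Fin t ⊎ Fin t → Fin n) → Injective _≡_ _≡_ e →
    (∀ i → Triangle x (e (inj₁ i)) (e (inj₂ i))) → ContainsFan t G
  containsFan {t} x e e-injective triangle = f , f-injective , f-edge
    where
    f : Fin (suc (t + t)) → Fin n
    f zero = x
    f (suc j) = e (splitAt t j)

    x≢e : ∀ k → x ≢ e k
    x≢e (inj₁ i) = adj⇒≢ (proj₁ (triangle i))
    x≢e (inj₂ i) = adj⇒≢ (proj₁ (proj₂ (triangle i)))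

    f-injective : Injective _≡_ _≡_ f
    f-injective {zero} {zero} _ = refl
    f-injective {zero} {suc j} eq = ⊥-elim (x≢e _ eq)
    f-injective {suc i} {zero} eq = ⊥-elim (x≢e _ (sym eq))
    f-injective {suc i} {suc j} eq = cong suc (begin
      i                      ≡⟨ sym (join-splitAt t t i) ⟩
      join t t (splitAt t i) ≡⟨ cong (join t t) (e-injective eq) ⟩
      join t t (splitAt t j) ≡⟨ join-splitAt t t j ⟩
      j                      ∎)
      where open ≡-Reasoning

    f-edge : ∀ a b → FanEdge t a b → Adj (f a) (f b)
    f-edge _ _ (uv i) rewrite splitAt-↑ˡ t i t = proj₁ (triangle i)
    f-edge _ _ (uw i) rewrite splitAt-↑ʳ t t i = proj₁ (proj₂ (triangle i))
    f-edge _ _ (vw i) rewrite splitAt-↑ˡ t i t | splitAt-↑ʳ t t i = proj₂ (proj₂ (triangle i))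

  matching⇒containsFan : ∀ {t} x {P} → All (uncurry (Triangle x)) P → Unique (vertices P) →
    t ≤ length P → ContainsFan t G
  matching⇒containsFan {t} x {P} triangles unique t≤ = containsFan x e e-injective triangle
    where
    spoke : Fin t → Bool → Fin n
    spoke i b = pick b (lookup P (inject≤ i t≤))

    spoke-injective : ∀ i j b c → spoke i b ≡ spoke j c → i ≡ j × b ≡ c
    spoke-injective i j b c eq =
      Product.map₁ (inject≤-injective t≤ t≤ i j) (pick-injective {P = P} unique _ _ b c eq)

    e : Fin t ⊎ Fin t → Fin n
    e (inj₁ i) = spoke i true
    e (inj₂ i) = spoke i false

    e-injective : Injective _≡_ _≡_ e
    e-injective {inj₁ i} {inj₁ j} eq = cong inj₁ (proj₁ (spoke-injective i j true true eq))
    e-injective {inj₂ i} {inj₂ j} eq = cong inj₂ (proj₁ (spoke-injective i j false false eq))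
    e-injective {inj₁ i} {inj₂ j} eq with spoke-injective i j true false eq
    ... | _ , ()
    e-injective {inj₂ i} {inj₁ j} eq with spoke-injective i j false true eq
    ... | _ , ()

    triangle : ∀ i → Triangle x (e (inj₁ i)) (e (inj₂ i))
    triangle i = All.lookup triangles (∈-lookup (inject≤ i t≤))

  module LinkMatching (x : Fin n) =
    GreedyMatching F._≟_ (triangle? x) (λ xyy → adj⇒≢ (proj₂ (proj₂ xyy)) refl)

  allPairs : List (Fin n × Fin n)
  allPairs = cartesianProduct (allFin n) (allFin n)

  linkMatching : Fin n → List (Fin n × Fin n)
  linkMatching x = LinkMatching.greedy x allPairs

  linkCover : Fin n → List (Fin n)
  linkCover x = vertices (linkMatching x)

  linkCover-covers : ∀ {x y z} → Triangle x y z → y ∈ linkCover x ⊎ z ∈ linkCover x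
  linkCover-covers {x} {y} {z} =
    LinkMatching.greedy-covers x allPairs (∈-cartesianProduct⁺ (∈-allFin y) (∈-allFin z))

  module _ {t : ℕ} (fan-free : ¬ ContainsFan t G) where

    length-linkMatching : ∀ x → length (linkMatching x) < t
    length-linkMatching x with t ≤? length (linkMatching x)
    ... | no t≰ = ≰⇒> t≰
    ... | yes t≤ = ⊥-elim (fan-free
      (uncurry (matching⇒containsFan x) (LinkMatching.greedy-isMatching x allPairs) t≤))

    length-linkCover : ∀ x → length (linkCover x) ≤ t + t
    length-linkCover x = begin
      length (linkCover x)                              ≡⟨ length-vertices (linkMatching x) ⟩
      length (linkMatching x) + length (linkMatching x) ≤⟨ +-mono-≤ t≥ t≥ ⟩
      t + t                                             ∎
      where
      open ≤-Reasoning
      t≥ : length (linkMatching x) ≤ t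
      t≥ = <⇒≤ (length-linkMatching x)

  IsClique : Subset n → Set
  IsClique S = ∀ {x y} → x ∈ₛ S → y ∈ₛ S → x ≢ y → Adj x y

  isClique⇒IsClique : ∀ S → isClique G S ≡ true → IsClique S
  isClique⇒IsClique S clique {x} {y} x∈S y∈S x≢y = edge (allV-true _ (allV-true _ clique x) y)
    where
    allV-true : (p : Fin n → Bool) → allV p ≡ true → ∀ i → p i ≡ true
    allV-true p all-p i = go (allFin n) all-p (∈-allFin i)
      where
      go : ∀ is → foldr (λ i b → p i ∧ b) true is ≡ true → i ∈ is → p i ≡ true
      go (j ∷ is) all-p (here refl) = ∧-conicalˡ _ _ all-p
      go (j ∷ is) all-p (there i∈is) = go is (∧-conicalʳ _ _ all-p) i∈is

    edge : (if memb S x ∧ memb S y then (if ⌊ x F.≟ y ⌋ then true else adj G x y) else true) ≡ true →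
           Adj x y
    edge rewrite x∈S | y∈S with x F.≟ y
    ... | yes x≡y = ⊥-elim (x≢y x≡y)
    ... | no _ = id

  isKr⇒IsClique : ∀ S {r} → (isClique G S ∧ ⌊ ∣ S ∣ ≟ r ⌋) ≡ true → IsClique S × ∣ S ∣ ≡ r
  isKr⇒IsClique S e = isClique⇒IsClique S (∧-conicalˡ (isClique G S) _ e) ,
                         toWitness (Equivalence.from T-≡ (∧-conicalʳ (isClique G S) _ e))

  module Hull (M : Fin n → List (Fin n))
              (covers : ∀ {x y z} → Triangle x y z → y ∈ M x ⊎ z ∈ M x) where

    hull : Fin n → List (Fin n)
    hull a = a ∷ M a ++ concatMap M (M a)

    ∈-hull₁ : ∀ {a v} → v ∈ M a → v ∈ hull a
    ∈-hull₁ v∈Ma = there (∈-++⁺ˡ v∈Ma)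

    ∈-hull₂ : ∀ {a y v} → y ∈ M a → v ∈ M y → v ∈ hull a
    ∈-hull₂ {a} y∈Ma v∈My = there (∈-++⁺ʳ (M a) (∈-concatMap⁺ M (lose y∈Ma v∈My)))

    length-hull : ∀ {k} → (∀ x → length (M x) ≤ k) → ∀ a → length (hull a) ≤ suc (k + k * k)
    length-hull {k} length-M a = s≤s (begin
      length (M a ++ concatMap M (M a))          ≡⟨ length-++ (M a) ⟩
      length (M a) + length (concatMap M (M a))  ≤⟨ +-mono-≤ (length-M a) (length-concatMap-≤ M length-M (M a)) ⟩
      k + length (M a) * k                       ≤⟨ +-monoʳ-≤ k (*-monoˡ-≤ k (length-M a)) ⟩
      k + k * k                                  ∎)
      where open ≤-Reasoning

    module _ (S : Subset n) (clique : IsClique S) (three : 3 ≤ ∣ S ∣) where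

      triangle : ∀ {x y z} → x ∈ₛ S → y ∈ₛ S → z ∈ₛ S → x ≢ y → x ≢ z → y ≢ z → Triangle x y z
      triangle x∈ y∈ z∈ x≢y x≢z y≢z = clique x∈ y∈ x≢y , clique x∈ z∈ x≢z , clique y∈ z∈ y≢z

      forced : ∀ {a x y} → a ∈ₛ S → x ∈ₛ S → y ∈ₛ S → x ∉ hull a → y ≢ a → y ≢ x → y ∈ M a
      forced a∈ x∈ y∈ x∉ y≢a y≢x
        with covers (triangle a∈ x∈ y∈ (λ a≡x → x∉ (here (sym a≡x))) (y≢a ∘ sym) (y≢x ∘ sym))
      ... | inj₁ x∈Ma = ⊥-elim (x∉ (∈-hull₁ x∈Ma))
      ... | inj₂ y∈Ma = y∈Ma

      escape-twice : ∀ {a x w} → a ∈ₛ S → x ∈ₛ S → w ∈ₛ S → x ∉ hull a → w ∉ hull x → ⊥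
      escape-twice {a} {x} {w} a∈ x∈ w∈ x∉ w∉ with w F.≟ a
      ... | no w≢a =
        w∉ (∈-hull₂ (forced x∈ w∈ a∈ w∉ (x≢a ∘ sym) (w≢a ∘ sym)) (forced a∈ x∈ w∈ x∉ w≢a w≢x))
        where
        x≢a : x ≢ a
        x≢a = x∉ ∘ here
        w≢x : w ≢ x
        w≢x = w∉ ∘ here
      -- w = a: a third vertex y of S lies in both M a and M x, and M y covers the triangle yxa.
      ... | yes refl with ∃∉-of-length< S (a ∷ x ∷ []) three
      ... | y , y∈ , y∉ with covers (triangle y∈ x∈ a∈ (y∉ ∘ there ∘ here) (y∉ ∘ here) (x∉ ∘ here))
      ...   | inj₁ x∈My = x∉ (∈-hull₂ (forced a∈ x∈ y∈ x∉ (y∉ ∘ here) (y∉ ∘ there ∘ here)) x∈My)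
      ...   | inj₂ a∈My = w∉ (∈-hull₂ (forced x∈ a∈ y∈ w∉ (y∉ ∘ there ∘ here) (y∉ ∘ here)) a∈My)

      clique-⊆-hull : ∃ λ a → ∀ v → v ∈ₛ S → v ∈ hull a
      clique-⊆-hull with ∃∉-of-length< S [] (≤-trans (s≤s z≤n) three)
      ... | a , a∈ , _ with ⊆-or-∃∉ S (hull a)
      ... | inj₁ S⊆hull = a , S⊆hull
      ... | inj₂ (x , x∈ , x∉) with ⊆-or-∃∉ S (hull x)
      ... | inj₁ S⊆hull = x , S⊆hull
      ... | inj₂ (w , w∈ , w∉) = ⊥-elim (escape-twice a∈ x∈ w∈ x∉ w∉)

proposition11 : (t r : ℕ) → t ≥ 1 → r ≥ 3 →
    ∃ λ C → ∀ (n : ℕ) (G : Graph n) → ¬ ContainsFan t G → numKr r G ≤ C * n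
proposition11 t r _ r≥3 = 2 ^ L , bound
  where
  L : ℕ
  L = suc ((t + t) + (t + t) * (t + t))

  bound : ∀ n (G : Graph n) → ¬ ContainsFan t G → numKr r G ≤ 2 ^ L * n
  bound n G fan-free = begin
    numKr r G  ≤⟨ count-localised hull (length-hull (length-linkCover G fan-free)) _ localised ⟩
    n * 2 ^ L  ≡⟨ *-comm n (2 ^ L) ⟩
    2 ^ L * n  ∎
    where
    open ≤-Reasoning
    open Hull G (linkCover G) (linkCover-covers G)

    localised : ∀ S → (isClique G S ∧ ⌊ ∣ S ∣ ≟ r ⌋) ≡ true → ∃ λ a → ∀ v → v ∈ₛ S → v ∈ hull a
    localised S e = let (clique , ∣S∣≡r) = isKr⇒IsClique G S e in
      clique-⊆-hull S clique (subst (3 ≤_) (sym ∣S∣≡r) r≥3)
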